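{- Let $k\ge 1$. Let $T_k$ be the tree on $3k+1$ vertices constructed as follows. Start with a root $r$ and $k$ disjoint paths $u_i m_i \ell_i$ for $i=1,\dots,k$, each on three vertices. Then add the edges $r u_i$ for $i=1,\dots,k$. Then $\gamma_{[1,2]}(T_k)=k+1$, and $T_k$ has at least $2^k$ distinct $\gamma_{[1,2]}$-sets. Consequently, the number of $\gamma_{[1,2]}$-sets of a tree on $n$ vertices is not bounded by any polynomial in $n$.
   Context: Let $G=(V,E)$ be a graph and $N(v)=\{u\in V: uv\in E\}$ the open neighborhood of $v$. A set $S\subseteq V$ is a $[1,2]$-set of $G$ if every vertex $v\in V\setminus S$ satisfies $1\le |N(v)\cap S|\le 2$. $\gamma_{[1,2]}(G)$ denotes the minimum cardinality of a $[1,2]$-set of $G$, and a $[1,2]$-set of this cardinality is called a $\gamma_{[1,2]}$-set. -}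

module Defs where

open import Data.Nat using (ℕ; zero; suc; _+_; _*_; _≤_; _≡ᵇ_)
open import Data.Bool using (Bool; true; false; _∧_; _∨_)
open import Data.Fin using (Fin; toℕ)
open import Data.Fin.Subset using (Subset; _∈_; _∉_; _∩_; ∣_∣)
open import Data.Vec using (tabulate)
open import Data.List using (List; []; _∷_; _++_; [_]; length; upTo)
open import Data.Bool.ListAction using (any)
open import Data.List.Relation.Unary.Unique.Propositional using (Unique)
open import Data.Product using (_×_; Σ; ∃; ∃-syntax)
open import Data.Sum using (_⊎_)
open import Data.Unit using (⊤)
open import Relation.Binary.PropositionalEquality using (_≡_)
open import Relation.Nullary using (¬_)

record Graph (n : ℕ) : Set where
  field
    adj : Fin n → Fin n → Bool

open Graph public

IsSimple : ∀ {n} → Graph n → Set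
IsSimple {n} G = (∀ u v → adj G u v ≡ adj G v u) × (∀ v → adj G v v ≡ false)

N : ∀ {n} → Graph n → Fin n → Subset n
N G v = tabulate (λ u → adj G v u)

Chain : ∀ {n} → Graph n → List (Fin n) → Set
Chain G [] = ⊤
Chain G (x ∷ []) = ⊤
Chain G (x ∷ y ∷ xs) = (adj G x y ≡ true) × Chain G (y ∷ xs)

Connected : ∀ {n} → Graph n → Set
Connected {n} G = ∀ (u v : Fin n) → u ≡ v ⊎ ∃[ xs ] Chain G (u ∷ xs ++ [ v ])

HasCycle : ∀ {n} → Graph n → Set
HasCycle {n} G =
  ∃[ x ] ∃[ ys ] ∃[ y ]
    (1 ≤ length ys × Unique (x ∷ ys ++ [ y ]) × Chain G (x ∷ ys ++ [ y ]) × adj G y x ≡ true)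

IsTree : ∀ {n} → Graph n → Set
IsTree G = IsSimple G × Connected G × ¬ HasCycle G

Is12Set : ∀ {n} → Graph n → Subset n → Set
Is12Set {n} G S = ∀ (v : Fin n) → v ∉ S → 1 ≤ ∣ N G v ∩ S ∣ × ∣ N G v ∩ S ∣ ≤ 2

IsGamma12 : ∀ {n} → Graph n → ℕ → Set
IsGamma12 {n} G m =
  (∃[ S ] (Is12Set G S × ∣ S ∣ ≡ m)) × (∀ (S : Subset n) → Is12Set G S → m ≤ ∣ S ∣)

IsGamma12Set : ∀ {n} → Graph n → Subset n → Set
IsGamma12Set {n} G S = Is12Set G S × (∀ (S' : Subset n) → Is12Set G S' → ∣ S ∣ ≤ ∣ S' ∣)

-- The tree T_k on 3k+1 vertices.
-- Vertex 0 is the root r; for i = 0,…,k-1, vertices 1+3i, 2+3i, 3+3i are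
-- u_{i+1}, m_{i+1}, ℓ_{i+1}.  Edges: r u_i, u_i m_i, m_i ℓ_i.

edgeℕ : ℕ → ℕ → ℕ → Bool
edgeℕ k a b = any (λ i → ((a ≡ᵇ 0) ∧ (b ≡ᵇ (1 + 3 * i)))
                       ∨ ((a ≡ᵇ (1 + 3 * i)) ∧ (b ≡ᵇ (2 + 3 * i)))
                       ∨ ((a ≡ᵇ (2 + 3 * i)) ∧ (b ≡ᵇ (3 + 3 * i))))
                  (upTo k)

T : (k : ℕ) → Graph (suc (3 * k))
T k = record { adj = λ a b → edgeℕ k (toℕ a) (toℕ b) ∨ edgeℕ k (toℕ b) (toℕ a) }

module Submission where

-- Label the vertices 0 (root) and vtx r i = 1 + offset r + 3i for
-- the head/middle/leaf of the i-th path.  Every edge joins a vertex to its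
-- parent, which has a smaller label; hence a vertex has at most one lower
-- neighbour, which forces acyclicity (a non-backtracking walk that rises keeps
-- rising, one that ends falling fell all along), and every vertex is joined to
-- the root, so T_k is a tree.  For β : ℕ → Bool the set S_β = {r} ∪ {m_i | β i}
-- ∪ {ℓ_i | ¬ β i} is a [1,2]-set with one vertex per path, hence of size k + 1.
-- Conversely any [1,2]-set S meets every path {m_i, ℓ_i} (a leaf outside S is
-- dominated by m_i) and, if r ∉ S, contains some u_i on top of that; counting S
-- path by path gives |S| ≥ k + 1.  The 2^k choices of β give distinct sets, and
-- 2^k eventually beats c·(3k+1)^d + c.

open import Defs
open import Data.Nat using (ℕ; zero; suc; _+_; _*_; _^_; _≤_; _<_; _≡ᵇ_; z≤n; s≤s; z<s; >-nonZero)
open import Data.Nat.Properties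
open import Data.Nat.Tactic.RingSolver using (solve-∀)
open import Data.Bool using (Bool; true; false; not; _∧_; _∨_) renaming (T to IsTrue)
open import Data.Bool.Properties using (T-∧; T-∨; T-≡; ∨-comm; not-injective)
open import Data.Fin using (Fin; toℕ; zero; fromℕ<)
open import Data.Fin.Subset
  using (Subset; _∈_; _∉_; _∩_; _∪_; ∣_∣; ⁅_⁆; Nonempty; inside; outside) renaming (⊥ to ∅)
open import Data.Fin.Subset.Properties
  using (p⊆q⇒∣p∣≤∣q∣; ∣⁅x⁆∣≡1; ∣⊥∣≡0; x∈⁅y⁆⇒x≡y; x∈⁅y⁆⇔x≡y; x∈p∪q⁺; x∈p∩q⁺; x∈p∩q⁻; nonempty?)
open import Data.Vec using (Vec; []; _∷_; tabulate; lookup; here; there)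
open import Data.Vec.Properties using (lookup∘tabulate; []=⇒lookup; lookup⇒[]=; ∷-injective)
import Data.Product as Product
open Product using (_×_; _,_; proj₁; proj₂; ∃-syntax)
open import Data.List using (List; []; _∷_; _++_; [_]; length; upTo; map; cartesianProductWith)
open import Data.List.Membership.Propositional using (find; lose)
open import Data.List.Membership.Propositional.Properties using (∈-upTo⁺; ∈-upTo⁻)
open import Data.List.Relation.Unary.Any.Properties using (any⁺; any⁻)
open import Data.List.Properties using (++-assoc; length-++; length-map)
open import Data.List.Relation.Unary.All as All using (All; []; _∷_)
open import Data.List.Relation.Unary.All.Properties using (++⁻ˡ; ++⁻ʳ) renaming (map⁺ to all-map⁺)
open import Data.List.Relation.Unary.AllPairs using ([]; _∷_)
open import Data.List.Relation.Unary.Unique.Propositional using (Unique)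
import Data.List.Relation.Unary.Unique.Propositional.Properties as Unique
open import Data.Unit using (⊤; tt)
open import Data.Empty using (⊥; ⊥-elim)
open import Data.Fin.Properties using (toℕ-injective; toℕ-fromℕ<; toℕ<n)
open import Relation.Binary.Definitions using (Tri; tri<; tri≈; tri>)
open import Data.Sum as Sum using (_⊎_; inj₁; inj₂)
open import Function using (_∘_; _⇔_; Equivalence; mk⇔)
open import Relation.Binary.PropositionalEquality hiding ([_])
open import Relation.Nullary using (¬_; yes; no; contradiction)

-- Sums over an initial segment of ℕ; subset sizes are computed as sums of bits.
bit : Bool → ℕ
bit true  = 1
bit false = 0

sumBelow : ℕ → (ℕ → ℕ) → ℕ
sumBelow zero    f = 0
sumBelow (suc n) f = f 0 + sumBelow n (f ∘ suc)

sumBelow-cong : ∀ n {f g : ℕ → ℕ} → (∀ {j} → j < n → f j ≡ g j) → sumBelow n f ≡ sumBelow n g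
sumBelow-cong zero    eq = refl
sumBelow-cong (suc n) eq = cong₂ _+_ (eq z<s) (sumBelow-cong n (eq ∘ s≤s))

sumBelow-+ : ∀ a b (f : ℕ → ℕ) → sumBelow (a + b) f ≡ sumBelow a f + sumBelow b (λ j → f (a + j))
sumBelow-+ zero    b f = refl
sumBelow-+ (suc a) b f = begin
  f 0 + sumBelow (a + b) (f ∘ suc)                                    ≡⟨ cong (f 0 +_) (sumBelow-+ a b (f ∘ suc)) ⟩
  f 0 + (sumBelow a (f ∘ suc) + sumBelow b (λ j → f (suc (a + j))))  ≡⟨ sym (+-assoc (f 0) _ _) ⟩
  f 0 + sumBelow a (f ∘ suc) + sumBelow b (λ j → f (suc (a + j)))    ∎
  where open ≡-Reasoning

sumBelow-blocks : ∀ c k (f : ℕ → ℕ) →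
  sumBelow (c * k) f ≡ sumBelow k (λ i → sumBelow c (λ p → f (p + c * i)))
sumBelow-blocks c zero    f rewrite *-zeroʳ c = refl
sumBelow-blocks c (suc k) f = begin
  sumBelow (c * suc k) f
    ≡⟨ cong (λ m → sumBelow m f) (*-suc c k) ⟩
  sumBelow (c + c * k) f
    ≡⟨ sumBelow-+ c (c * k) f ⟩
  sumBelow c f + sumBelow (c * k) (λ j → f (c + j))
    ≡⟨ cong₂ _+_ (sumBelow-cong c (λ {p} _ → cong f (sym (first p))))
                 (sumBelow-blocks c k (λ j → f (c + j))) ⟩
  sumBelow c (λ p → f (p + c * 0)) + sumBelow k (λ i → sumBelow c (λ p → f (c + (p + c * i))))
    ≡⟨ cong (sumBelow c (λ p → f (p + c * 0)) +_)
         (sumBelow-cong k (λ {i} _ → sumBelow-cong c (λ {p} _ → cong f (next p i)))) ⟩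
  sumBelow (suc k) (λ i → sumBelow c (λ p → f (p + c * i)))
    ∎
  where
  open ≡-Reasoning
  first : ∀ p → p + c * 0 ≡ p
  first p rewrite *-zeroʳ c = +-identityʳ p
  next : ∀ p i → c + (p + c * i) ≡ p + c * suc i
  next p i = trans (left-comm c p (c * i)) (cong (p +_) (sym (*-suc c i)))
    where
    left-comm : ∀ x y z → x + (y + z) ≡ y + (x + z)
    left-comm = solve-∀

sumBelow-lower : ∀ k (f : ℕ → ℕ) → (∀ {i} → i < k → 1 ≤ f i) → k ≤ sumBelow k f
sumBelow-lower zero    f pos = z≤n
sumBelow-lower (suc k) f pos = +-mono-≤ (pos z<s) (sumBelow-lower k (f ∘ suc) (pos ∘ s≤s))

sumBelow-lower-strict : ∀ k (f : ℕ → ℕ) → (∀ {i} → i < k → 1 ≤ f i) →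
  ∀ {i} → i < k → 2 ≤ f i → suc k ≤ sumBelow k f
sumBelow-lower-strict (suc k) f pos {zero}  _         big = +-mono-≤ big (sumBelow-lower k (f ∘ suc) (pos ∘ s≤s))
sumBelow-lower-strict (suc k) f pos {suc i} (s≤s i<k) big =
  +-mono-≤ (pos z<s) (sumBelow-lower-strict k (f ∘ suc) (pos ∘ s≤s) i<k big)

sumBelow-ones : ∀ k (f : ℕ → ℕ) → (∀ {i} → i < k → f i ≡ 1) → sumBelow k f ≡ k
sumBelow-ones zero    f one = refl
sumBelow-ones (suc k) f one = cong₂ _+_ (one z<s) (sumBelow-ones k (f ∘ suc) (one ∘ s≤s))

member : ∀ {n} → Subset n → ℕ → Bool
member []      j       = false
member (b ∷ p) zero    = b
member (b ∷ p) (suc j) = member p j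

member-injective : ∀ {n} (p q : Vec Bool n) → (∀ {i} → i < n → member p i ≡ member q i) → p ≡ q
member-injective []      []      _    = refl
member-injective (x ∷ p) (y ∷ q) same = cong₂ _∷_ (same z<s) (member-injective p q (same ∘ s≤s))

card-member : ∀ {n} (p : Subset n) → ∣ p ∣ ≡ sumBelow n (bit ∘ member p)
card-member []            = refl
card-member (inside ∷ p)  = cong suc (card-member p)
card-member (outside ∷ p) = card-member p

∈⇒member : ∀ {n} {p : Subset n} {v : Fin n} → v ∈ p → member p (toℕ v) ≡ true
∈⇒member here        = refl
∈⇒member (there v∈p) = ∈⇒member v∈p

∈-tabulate : ∀ {n} (f : Fin n → Bool) {v : Fin n} → v ∈ tabulate f ⇔ f v ≡ true
∈-tabulate f {v} = mk⇔
  (λ v∈ → trans (sym (lookup∘tabulate f v)) ([]=⇒lookup v∈))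
  (λ fv → lookup⇒[]= v (tabulate f) (trans (lookup∘tabulate f v) fv))

card-tabulate : ∀ n (h : ℕ → Bool) → ∣ tabulate {n = n} (h ∘ toℕ) ∣ ≡ sumBelow n (bit ∘ h)
card-tabulate zero    h = refl
card-tabulate (suc n) h with h 0
... | true  = cong suc (card-tabulate n (h ∘ suc))
... | false = card-tabulate n (h ∘ suc)

∣p∪q∣≤∣p∣+∣q∣ : ∀ {n} (p q : Subset n) → ∣ p ∪ q ∣ ≤ ∣ p ∣ + ∣ q ∣
∣p∪q∣≤∣p∣+∣q∣ []            []            = z≤n
∣p∪q∣≤∣p∣+∣q∣ (inside ∷ p)  (inside ∷ q)  =
  s≤s (≤-trans (∣p∪q∣≤∣p∣+∣q∣ p q) (≤-trans (n≤1+n _) (≤-reflexive (sym (+-suc ∣ p ∣ ∣ q ∣)))))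
∣p∪q∣≤∣p∣+∣q∣ (inside ∷ p)  (outside ∷ q) = s≤s (∣p∪q∣≤∣p∣+∣q∣ p q)
∣p∪q∣≤∣p∣+∣q∣ (outside ∷ p) (inside ∷ q)  =
  ≤-trans (s≤s (∣p∪q∣≤∣p∣+∣q∣ p q)) (≤-reflexive (sym (+-suc ∣ p ∣ ∣ q ∣)))
∣p∪q∣≤∣p∣+∣q∣ (outside ∷ p) (outside ∷ q) = ∣p∪q∣≤∣p∣+∣q∣ p q

∈⇒card≥1 : ∀ {n} {p : Subset n} {x : Fin n} → x ∈ p → 1 ≤ ∣ p ∣
∈⇒card≥1 {p = p} {x} x∈p = subst (_≤ ∣ p ∣) (∣⁅x⁆∣≡1 x) (p⊆q⇒∣p∣≤∣q∣ ⁅x⁆⊆p)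
  where
  ⁅x⁆⊆p : ∀ {y} → y ∈ ⁅ x ⁆ → y ∈ p
  ⁅x⁆⊆p y∈⁅x⁆ = subst (_∈ p) (sym (x∈⁅y⁆⇒x≡y x y∈⁅x⁆)) x∈p

card≥1⇒nonempty : ∀ {n} (p : Subset n) → 1 ≤ ∣ p ∣ → Nonempty p
card≥1⇒nonempty {n} p 1≤∣p∣ with nonempty? p
... | yes ne = ne
... | no ¬ne = contradiction (≤-trans 1≤∣p∣ (≤-trans (p⊆q⇒∣p∣≤∣q∣ p⊆∅) (≤-reflexive (∣⊥∣≡0 n)))) λ ()
  where
  p⊆∅ : ∀ {y} → y ∈ p → y ∈ ∅
  p⊆∅ y∈p = contradiction (_ , y∈p) ¬ne

card≤2 : ∀ {n} (p : Subset n) (a b : Fin n) → (∀ {x} → x ∈ p → x ≡ a ⊎ x ≡ b) → ∣ p ∣ ≤ 2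
card≤2 p a b within = begin
  ∣ p ∣                   ≤⟨ p⊆q⇒∣p∣≤∣q∣ (x∈p∪q⁺ ∘ Sum.map singleton singleton ∘ within) ⟩
  ∣ ⁅ a ⁆ ∪ ⁅ b ⁆ ∣       ≤⟨ ∣p∪q∣≤∣p∣+∣q∣ ⁅ a ⁆ ⁅ b ⁆ ⟩
  ∣ ⁅ a ⁆ ∣ + ∣ ⁅ b ⁆ ∣   ≡⟨ cong₂ _+_ (∣⁅x⁆∣≡1 a) (∣⁅x⁆∣≡1 b) ⟩
  2                       ∎
  where
  open ≤-Reasoning
  singleton : ∀ {x y} → x ≡ y → x ∈ ⁅ y ⁆
  singleton = Equivalence.from x∈⁅y⁆⇔x≡y

allVecs : ∀ k → List (Vec Bool k)
allVecs zero    = [] ∷ []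
allVecs (suc k) = cartesianProductWith _∷_ (true ∷ false ∷ []) (allVecs k)

length-allVecs : ∀ k → length (allVecs k) ≡ 2 ^ k
length-allVecs zero    = refl
length-allVecs (suc k) = begin
  length (map (true ∷_) vs ++ map (false ∷_) vs ++ [])
    ≡⟨ length-++ (map (true ∷_) vs) ⟩
  length (map (true ∷_) vs) + length (map (false ∷_) vs ++ [])
    ≡⟨ cong (length (map (true ∷_) vs) +_) (length-++ (map (false ∷_) vs)) ⟩
  length (map (true ∷_) vs) + (length (map (false ∷_) vs) + 0)
    ≡⟨ cong₂ (λ a b → a + (b + 0)) (length-map (true ∷_) vs) (length-map (false ∷_) vs) ⟩
  length vs + (length vs + 0)
    ≡⟨ cong (λ a → a + (a + 0)) (length-allVecs k) ⟩
  2 ^ suc k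
    ∎
  where
  open ≡-Reasoning
  vs = allVecs k

unique-allVecs : ∀ k → Unique (allVecs k)
unique-allVecs zero    = [] ∷ []
unique-allVecs (suc k) =
  Unique.cartesianProductWith⁺ _∷_ ∷-injective ((true≢false ∷ []) ∷ [] ∷ []) (unique-allVecs k)
  where
  true≢false : true ≢ false
  true≢false ()

module _ {n : ℕ} (G : Graph n) where

  ∈N⇔adj : ∀ {v w} → w ∈ N G v ⇔ adj G v w ≡ true
  ∈N⇔adj {v} = ∈-tabulate (adj G v)

  neighbour⇒card≥1 : ∀ {v w} (S : Subset n) → adj G v w ≡ true → w ∈ S → 1 ≤ ∣ N G v ∩ S ∣
  neighbour⇒card≥1 S vw w∈S = ∈⇒card≥1 (x∈p∩q⁺ (Equivalence.from ∈N⇔adj vw , w∈S))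

  neighbours⇒card≤2 : ∀ {v} (S : Subset n) (a b : Fin n) →
    (∀ {w} → adj G v w ≡ true → w ≡ a ⊎ w ≡ b) → ∣ N G v ∩ S ∣ ≤ 2
  neighbours⇒card≤2 {v} S a b within =
    card≤2 (N G v ∩ S) a b (λ w∈ → within (Equivalence.to ∈N⇔adj (proj₁ (x∈p∩q⁻ (N G v) S w∈))))

  dominated : ∀ {S v} → Is12Set G S → v ∉ S → ∃[ w ] (adj G v w ≡ true × w ∈ S)
  dominated {S} {v} is12 v∉S with card≥1⇒nonempty (N G v ∩ S) (proj₁ (is12 v v∉S))
  ... | w , w∈ with x∈p∩q⁻ (N G v) S w∈
  ...   | w∈N , w∈S = w , Equivalence.to ∈N⇔adj w∈N , w∈S

  chain-++ : ∀ u xs v zs → Chain G (u ∷ xs ++ [ v ]) → Chain G (v ∷ zs) → Chain G (u ∷ xs ++ v ∷ zs)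
  chain-++ u []       v zs (uv , _)  vzs = uv , vzs
  chain-++ u (x ∷ xs) v zs (ux , xvs) vzs = ux , chain-++ x xs v zs xvs vzs

  Reachable : Fin n → Fin n → Set
  Reachable u v = u ≡ v ⊎ ∃[ xs ] Chain G (u ∷ xs ++ [ v ])

  reach-trans : ∀ {u v w} → Reachable u v → Reachable v w → Reachable u w
  reach-trans (inj₁ refl) vw          = vw
  reach-trans uv          (inj₁ refl) = uv
  reach-trans {u} {v} {w} (inj₂ (xs , uv)) (inj₂ (ys , vw)) =
    inj₂ (xs ++ v ∷ ys , subst (λ l → Chain G (u ∷ l)) (sym (++-assoc xs (v ∷ ys) [ w ]))
                               (chain-++ u xs v (ys ++ [ w ]) uv vw))

  connected-via : (r : Fin n) → (∀ v → Reachable v r × Reachable r v) → Connected G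
  connected-via r hub u v = reach-trans (proj₁ (hub u)) (proj₂ (hub v))

UniqueParents : ∀ {n} → Graph n → Set
UniqueParents {n} G = ∀ {v a b : Fin n} → adj G v a ≡ true → adj G v b ≡ true →
                      toℕ a < toℕ v → toℕ b < toℕ v → a ≡ b

module Acyclic {n : ℕ} (G : Graph n) (simple : IsSimple G) (parents : UniqueParents G) where

  _≺_ : Fin n → Fin n → Set
  a ≺ b = toℕ a < toℕ b

  adj-sym : ∀ {a b} → adj G a b ≡ true → adj G b a ≡ true
  adj-sym {a} {b} ab = trans (proj₁ simple b a) ab

  adj⇒≢ : ∀ {a b} → adj G a b ≡ true → toℕ a ≢ toℕ b
  adj⇒≢ {a} ab eq with toℕ-injective eq
  ... | refl with trans (sym ab) (proj₂ simple a)
  ...   | ()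

  no-peak : ∀ {a b c} → adj G a b ≡ true → adj G b c ≡ true → a ≢ c → a ≺ b → c ≺ b → ⊥
  no-peak ab bc a≢c a≺b c≺b = a≢c (parents (adj-sym ab) bc a≺b c≺b)

  keeps-rising : ∀ {a b c} → adj G a b ≡ true → adj G b c ≡ true → a ≢ c → a ≺ b → b ≺ c
  keeps-rising {b = b} {c} ab bc a≢c a≺b with <-cmp (toℕ b) (toℕ c)
  ... | tri< b≺c _ _ = b≺c
  ... | tri≈ _ b=c _ = contradiction b=c (adj⇒≢ bc)
  ... | tri> _ _ c≺b = ⊥-elim (no-peak ab bc a≢c a≺b c≺b)

  fell-before : ∀ {a b c} → adj G a b ≡ true → adj G b c ≡ true → a ≢ c → c ≺ b → b ≺ a
  fell-before {a} {b} ab bc a≢c c≺b with <-cmp (toℕ a) (toℕ b)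
  ... | tri< a≺b _ _ = ⊥-elim (no-peak ab bc a≢c a≺b c≺b)
  ... | tri≈ _ a=b _ = contradiction a=b (adj⇒≢ ab)
  ... | tri> _ _ b≺a = b≺a

  NonBacktracking : List (Fin n) → Set
  NonBacktracking (a ∷ b ∷ c ∷ l) = a ≢ c × NonBacktracking (b ∷ c ∷ l)
  NonBacktracking _               = ⊤

  final : Fin n → List (Fin n) → Fin n
  final a []      = a
  final a (b ∷ l) = final b l

  EndsFalling : Fin n → Fin n → List (Fin n) → Set
  EndsFalling a b []      = b ≺ a
  EndsFalling a b (c ∷ l) = EndsFalling b c l

  rising : ∀ a b l → Chain G (a ∷ b ∷ l) → NonBacktracking (a ∷ b ∷ l) → a ≺ b → a ≺ final b l
  rising a b []      _              _          a≺b = a≺b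
  rising a b (c ∷ l) (ab , bc , ch) (a≢c , nb) a≺b =
    <-trans a≺b (rising b c l (bc , ch) nb (keeps-rising ab bc a≢c a≺b))

  falling : ∀ a b l → Chain G (a ∷ b ∷ l) → NonBacktracking (a ∷ b ∷ l) → EndsFalling a b l →
            b ≺ a × final b l ≺ a
  falling a b []      _              _          b≺a  = b≺a , b≺a
  falling a b (c ∷ l) (ab , bc , ch) (a≢c , nb) ends with falling b c l (bc , ch) nb ends
  ... | c≺b , end≺b = b≺a , <-trans end≺b b≺a
    where b≺a = fell-before ab bc a≢c c≺b

  -- Closing a walk a b … y of distinct vertices by the steps y, x does not
  -- backtrack provided x differs from b, … (used with x = a: once around a cycle).
  closing-nonBacktracking : ∀ a b l {x y} → Unique (a ∷ b ∷ l ++ [ y ]) → All (_≢ x) (b ∷ l) →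
                            NonBacktracking (a ∷ b ∷ l ++ y ∷ x ∷ [])
  closing-nonBacktracking a b []      ((_ ∷ a≢y ∷ []) ∷ _) (b≢x ∷ [])  = a≢y , b≢x , tt
  closing-nonBacktracking a b (c ∷ l) ((_ ∷ a≢c ∷ _) ∷ u)  (_ ∷ c∷l≢x) =
    a≢c , closing-nonBacktracking b c l u c∷l≢x

  final-closing : ∀ b l x y → final b (l ++ y ∷ x ∷ []) ≡ x
  final-closing b []      x y = refl
  final-closing b (c ∷ l) x y = final-closing c l x y

  ends-falling-closing : ∀ a b l {x y} → x ≺ y → EndsFalling a b (l ++ y ∷ x ∷ [])
  ends-falling-closing a b []      x≺y = x≺y
  ends-falling-closing a b (c ∷ l) x≺y = ends-falling-closing b c l x≺y

  -- Walk around a cycle x y₁ … y x: if it starts rising it ends above x, if both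
  -- x–y₁ and x–y fall then x has two parents, otherwise it ends falling below x.
  acyclic : ¬ HasCycle G
  acyclic (x , []      , y , ()  , _)
  acyclic (x , y₁ ∷ ys , y , _ , unique@(x≢ ∷ y₁≢ ∷ _) , chain , yx) =
    around (<-cmp (toℕ x) (toℕ y₁))
    where
    rest : List (Fin n)
    rest = ys ++ y ∷ x ∷ []

    walk-chain : Chain G (x ∷ y₁ ∷ rest)
    walk-chain = chain-++ G x (y₁ ∷ ys) y (x ∷ []) chain (yx , tt)

    walk-nb : NonBacktracking (x ∷ y₁ ∷ rest)
    walk-nb = closing-nonBacktracking x y₁ ys unique (All.map ≢-sym (++⁻ˡ (y₁ ∷ ys) x≢))

    returns : final y₁ rest ≡ x
    returns = final-closing y₁ ys x y

    y₁≢y : y₁ ≢ y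
    y₁≢y = All.head (++⁻ʳ ys y₁≢)

    around : Tri (x ≺ y₁) (toℕ x ≡ toℕ y₁) (y₁ ≺ x) → ⊥
    around (tri< x≺y₁ _ _) = <-irrefl (cong toℕ (sym returns)) (rising x y₁ rest walk-chain walk-nb x≺y₁)
    around (tri≈ _ x=y₁ _) = adj⇒≢ (proj₁ chain) x=y₁
    around (tri> _ _ y₁≺x) with <-cmp (toℕ y) (toℕ x)
    ... | tri< y≺x _ _ = y₁≢y (parents (proj₁ chain) (adj-sym yx) y₁≺x y≺x)
    ... | tri≈ _ y=x _ = adj⇒≢ yx y=x
    ... | tri> _ _ x≺y = <-irrefl (cong toℕ returns)
                           (proj₂ (falling x y₁ rest walk-chain walk-nb (ends-falling-closing x y₁ ys x≺y)))

-- The vertices of T_k: the root has label 0, and the head u_i, middle m_i and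
-- leaf ℓ_i of the i-th path have labels 1 + 3i, 2 + 3i, 3 + 3i, as in Defs.
data Role : Set where
  head middle leaf : Role

offset : Role → ℕ
offset head   = 0
offset middle = 1
offset leaf   = 2

vtx : Role → ℕ → ℕ
vtx r i = suc (offset r + 3 * i)

u m ℓ : ℕ → ℕ
u = vtx head
m = vtx middle
ℓ = vtx leaf

vtx-suc : ∀ r i → vtx r (suc i) ≡ 3 + vtx r i
vtx-suc r i = cong suc (shift (offset r) i)
  where
  shift : ∀ p i → p + 3 * suc i ≡ 3 + (p + 3 * i)
  shift = solve-∀

-- The edges of T_k, each directed from its smaller to its larger label.
data Edge (k a b : ℕ) : Set where
  root-head   : ∀ i → i < k → a ≡ 0   → b ≡ u i → Edge k a b
  head-middle : ∀ i → i < k → a ≡ u i → b ≡ m i → Edge k a b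
  middle-leaf : ∀ i → i < k → a ≡ m i → b ≡ ℓ i → Edge k a b

edgeAt : ℕ → ℕ → ℕ → Bool
edgeAt a b i = ((a ≡ᵇ 0) ∧ (b ≡ᵇ u i))
             ∨ ((a ≡ᵇ u i) ∧ (b ≡ᵇ m i))
             ∨ ((a ≡ᵇ m i) ∧ (b ≡ᵇ ℓ i))

both≡ : ∀ a x b y → IsTrue ((a ≡ᵇ x) ∧ (b ≡ᵇ y)) ⇔ (a ≡ x × b ≡ y)
both≡ a x b y = mk⇔
  (λ t → let ax , by = Equivalence.to T-∧ t in ≡ᵇ⇒≡ a x ax , ≡ᵇ⇒≡ b y by)
  (λ (ax , by) → Equivalence.from T-∧ (≡⇒≡ᵇ a x ax , ≡⇒≡ᵇ b y by))

edgeAt⇔ : ∀ a b i → IsTrue (edgeAt a b i) ⇔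
  ((a ≡ 0 × b ≡ u i) ⊎ (a ≡ u i × b ≡ m i) ⊎ (a ≡ m i × b ≡ ℓ i))
edgeAt⇔ a b i = mk⇔
  (λ t → Sum.map (to (both≡ a 0 b (u i))) (Sum.map (to (both≡ a (u i) b (m i))) (to (both≡ a (m i) b (ℓ i))))
                 (Sum.map₂ (to T-∨) (to T-∨ t)))
  (λ e → from T-∨ (Sum.map (from (both≡ a 0 b (u i))) (λ e′ → from T-∨
                 (Sum.map (from (both≡ a (u i) b (m i))) (from (both≡ a (m i) b (ℓ i))) e′)) e))
  where open Equivalence

edge-sound : ∀ k a b → IsTrue (edgeℕ k a b) → Edge k a b
edge-sound k a b holds with find (any⁻ (edgeAt a b) (upTo k) holds)
... | i , i∈ , hit with Equivalence.to (edgeAt⇔ a b i) hit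
... | inj₁ (a≡ , b≡)        = root-head   i (∈-upTo⁻ i∈) a≡ b≡
... | inj₂ (inj₁ (a≡ , b≡)) = head-middle i (∈-upTo⁻ i∈) a≡ b≡
... | inj₂ (inj₂ (a≡ , b≡)) = middle-leaf i (∈-upTo⁻ i∈) a≡ b≡

edge-witness : ∀ {k a b} → Edge k a b → ∃[ i ] (i < k × IsTrue (edgeAt a b i))
edge-witness {a = a} {b} (root-head   i i<k a≡ b≡) =
  i , i<k , Equivalence.from (edgeAt⇔ a b i) (inj₁ (a≡ , b≡))
edge-witness {a = a} {b} (head-middle i i<k a≡ b≡) =
  i , i<k , Equivalence.from (edgeAt⇔ a b i) (inj₂ (inj₁ (a≡ , b≡)))
edge-witness {a = a} {b} (middle-leaf i i<k a≡ b≡) =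
  i , i<k , Equivalence.from (edgeAt⇔ a b i) (inj₂ (inj₂ (a≡ , b≡)))

edge-complete : ∀ {k a b} → Edge k a b → IsTrue (edgeℕ k a b)
edge-complete {a = a} {b} e =
  let i , i<k , hit = edge-witness e in any⁺ (edgeAt a b) (lose (∈-upTo⁺ i<k) hit)

Adjacent : ℕ → ℕ → ℕ → Set
Adjacent k a b = Edge k a b ⊎ Edge k b a

module _ (k : ℕ) where

  adj⇒adjacent : ∀ {v w} → adj (T k) v w ≡ true → Adjacent k (toℕ v) (toℕ w)
  adj⇒adjacent vw =
    Sum.map (edge-sound k _ _) (edge-sound k _ _) (Equivalence.to T-∨ (Equivalence.from T-≡ vw))

  adjacent⇒adj : ∀ {v w} → Adjacent k (toℕ v) (toℕ w) → adj (T k) v w ≡ true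
  adjacent⇒adj vw = Equivalence.to T-≡ (Equivalence.from T-∨ (Sum.map edge-complete edge-complete vw))

-- The role and path index of a non-root label (the value at 0 is irrelevant).
locate : ℕ → Role × ℕ
locate 0 = head , 0
locate 1 = head , 0
locate 2 = middle , 0
locate 3 = leaf , 0
locate (suc (suc (suc (suc j)))) = Product.map₂ suc (locate (suc j))

locate-vtx : ∀ r i → locate (vtx r i) ≡ (r , i)
locate-vtx head   zero    = refl
locate-vtx middle zero    = refl
locate-vtx leaf   zero    = refl
locate-vtx r      (suc i) = trans (cong locate (vtx-suc r i)) (cong (Product.map₂ suc) (locate-vtx r i))

parentAt : Role × ℕ → ℕ
parentAt (head   , i) = 0
parentAt (middle , i) = u i
parentAt (leaf   , i) = m i

parent : ℕ → ℕ
parent = parentAt ∘ locate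

parent-u : ∀ i → parent (u i) ≡ 0
parent-u i = cong parentAt (locate-vtx head i)

parent-m : ∀ i → parent (m i) ≡ u i
parent-m i = cong parentAt (locate-vtx middle i)

parent-ℓ : ∀ i → parent (ℓ i) ≡ m i
parent-ℓ i = cong parentAt (locate-vtx leaf i)

module _ {k : ℕ} where

  edge-rises : ∀ {a b} → Edge k a b → a < b
  edge-rises (root-head   i _ refl refl) = z<s
  edge-rises (head-middle i _ refl refl) = n<1+n _
  edge-rises (middle-leaf i _ refl refl) = n<1+n _

  edge-parent : ∀ {a b} → Edge k a b → a ≡ parent b
  edge-parent (root-head   i _ refl refl) = sym (parent-u i)
  edge-parent (head-middle i _ refl refl) = sym (parent-m i)
  edge-parent (middle-leaf i _ refl refl) = sym (parent-ℓ i)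

  edge-next : ∀ {a b} → Edge k (suc a) b → b ≡ suc (suc a)
  edge-next (root-head   i _ () _)
  edge-next (head-middle i _ refl refl) = refl
  edge-next (middle-leaf i _ refl refl) = refl

  lower-neighbour : ∀ {x y} → Adjacent k x y → y < x → y ≡ parent x
  lower-neighbour (inj₁ e) y<x = contradiction (edge-rises e) (<-asym y<x)
  lower-neighbour (inj₂ e) _   = edge-parent e

  neighbours : ∀ {a j} → Adjacent k (suc a) j → j ≡ parent (suc a) ⊎ j ≡ suc (suc a)
  neighbours (inj₁ e) = inj₂ (edge-next e)
  neighbours (inj₂ e) = inj₁ (edge-parent e)

  head-neighbours : ∀ {i j} → Adjacent k (u i) j → j ≡ 0 ⊎ j ≡ m i
  head-neighbours {i} e = Sum.map₁ (λ j≡ → trans j≡ (parent-u i)) (neighbours e)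

  middle-neighbours : ∀ {i j} → Adjacent k (m i) j → j ≡ u i ⊎ j ≡ ℓ i
  middle-neighbours {i} e = Sum.map₁ (λ j≡ → trans j≡ (parent-m i)) (neighbours e)

  leaf-neighbour : ∀ {i j} → Adjacent k (ℓ i) j → j ≡ m i
  leaf-neighbour {i} (inj₂ e) = trans (edge-parent e) (parent-ℓ i)
  leaf-neighbour {i} (inj₁ e) with refl ← edge-next e =
    contradiction (trans (edge-parent e) (trans (cong parent (sym (vtx-suc head i))) (parent-u (suc i)))) λ ()

  root-neighbours : ∀ {j} → Adjacent k 0 j → ∃[ i ] (i < k × j ≡ u i)
  root-neighbours (inj₁ (root-head   i i<k _ j≡)) = i , i<k , j≡
  root-neighbours (inj₁ (head-middle i _ () _))
  root-neighbours (inj₁ (middle-leaf i _ () _))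
  root-neighbours (inj₂ e) = contradiction (edge-rises e) λ ()

label : ∀ j → j ≡ 0 ⊎ ∃[ r ] ∃[ i ] j ≡ vtx r i
label 0 = inj₁ refl
label 1 = inj₂ (head , 0 , refl)
label 2 = inj₂ (middle , 0 , refl)
label (suc (suc (suc j))) with label j
... | inj₁ refl           = inj₂ (leaf , 0 , refl)
... | inj₂ (r , i , refl) = inj₂ (r , suc i , sym (vtx-suc r i))

offset≤2 : ∀ r → offset r ≤ 2
offset≤2 head   = z≤n
offset≤2 middle = s≤s z≤n
offset≤2 leaf   = ≤-refl

vtx-bound⇒ : ∀ {k} r i → vtx r i < suc (3 * k) → i < k
vtx-bound⇒ r i (s≤s r+3i<3k) = *-cancelˡ-< 3 i _ (≤-trans (s≤s (m≤n+m (3 * i) (offset r))) r+3i<3k)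

vtx-bound⇐ : ∀ {k} r {i} → i < k → vtx r i < suc (3 * k)
vtx-bound⇐ {k} r {i} i<k = s≤s (begin
  suc (offset r + 3 * i) ≤⟨ s≤s (+-monoˡ-≤ (3 * i) (offset≤2 r)) ⟩
  3 + 3 * i              ≡⟨ sym (*-suc 3 i) ⟩
  3 * suc i              ≤⟨ *-monoʳ-≤ 3 i<k ⟩
  3 * k                  ∎)
  where open ≤-Reasoning

module _ {k : ℕ} where

  Position : Fin (suc (3 * k)) → Set
  Position v = toℕ v ≡ 0 ⊎ ∃[ r ] ∃[ i ] (i < k × toℕ v ≡ vtx r i)

  position : ∀ v → Position v
  position v with label (toℕ v)
  ... | inj₁ v≡0          = inj₁ v≡0
  ... | inj₂ (r , i , v≡) = inj₂ (r , i , vtx-bound⇒ r i (subst (_< suc (3 * k)) v≡ (toℕ<n v)) , v≡)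

  vertex : ∀ r {i} → i < k → Fin (suc (3 * k))
  vertex r i<k = fromℕ< (vtx-bound⇐ r i<k)

  toℕ-vertex : ∀ r {i} (i<k : i < k) → toℕ (vertex r i<k) ≡ vtx r i
  toℕ-vertex r i<k = toℕ-fromℕ< (vtx-bound⇐ r i<k)

  edge⇒adj : ∀ {v w} → Edge k (toℕ v) (toℕ w) → adj (T k) v w ≡ true × adj (T k) w v ≡ true
  edge⇒adj e = adjacent⇒adj k (inj₁ e) , adjacent⇒adj k (inj₂ e)

  T-simple : IsSimple (T k)
  T-simple = (λ v w → ∨-comm (edgeℕ k (toℕ v) (toℕ w)) _) , loopless
    where
    loopless : ∀ v → adj (T k) v v ≡ false
    loopless v with adj (T k) v v in vv
    ... | false = refl
    ... | true  = ⊥-elim (no-loop (adj⇒adjacent k {v} {v} vv))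
      where
      no-loop : ∀ {a} → Adjacent k a a → ⊥
      no-loop (inj₁ e) = <-irrefl refl (edge-rises e)
      no-loop (inj₂ e) = <-irrefl refl (edge-rises e)

  T-parents : UniqueParents (T k)
  T-parents va vb a<v b<v = toℕ-injective
    (trans (lower-neighbour (adj⇒adjacent k va) a<v) (sym (lower-neighbour (adj⇒adjacent k vb) b<v)))

  hub : ∀ v → Reachable (T k) v zero × Reachable (T k) zero v
  hub v with position v
  ... | inj₁ v≡0 = inj₁ (toℕ-injective v≡0) , inj₁ (sym (toℕ-injective v≡0))
  ... | inj₂ (head , i , i<k , v≡) =
    let r↑v , v↓r = edge⇒adj {zero} {v} (root-head i i<k refl v≡)
    in inj₂ ([] , v↓r , tt) , inj₂ ([] , r↑v , tt)
  ... | inj₂ (middle , i , i<k , v≡) =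
    let h = vertex head i<k
        r↑h , h↓r = edge⇒adj {zero} {h} (root-head i i<k refl (toℕ-vertex head i<k))
        h↑v , v↓h = edge⇒adj {h} {v} (head-middle i i<k (toℕ-vertex head i<k) v≡)
    in inj₂ (h ∷ [] , v↓h , h↓r , tt) , inj₂ (h ∷ [] , r↑h , h↑v , tt)
  ... | inj₂ (leaf , i , i<k , v≡) =
    let h = vertex head i<k
        c = vertex middle i<k
        r↑h , h↓r = edge⇒adj {zero} {h} (root-head i i<k refl (toℕ-vertex head i<k))
        h↑c , c↓h = edge⇒adj {h} {c} (head-middle i i<k (toℕ-vertex head i<k) (toℕ-vertex middle i<k))
        c↑v , v↓c = edge⇒adj {c} {v} (middle-leaf i i<k (toℕ-vertex middle i<k) v≡)
    in inj₂ (c ∷ h ∷ [] , v↓c , c↓h , h↓r , tt) , inj₂ (h ∷ c ∷ [] , r↑h , h↑c , c↑v , tt)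

  T-tree : IsTree (T k)
  T-tree = T-simple , connected-via (T k) zero hub , Acyclic.acyclic (T k) T-simple T-parents

onPath : (ℕ → Bool) → ℕ → ℕ
onPath h i = sumBelow 3 (λ p → bit (h (suc (p + 3 * i))))

count-T : ∀ k (h : ℕ → Bool) → sumBelow (suc (3 * k)) (bit ∘ h) ≡ bit (h 0) + sumBelow k (onPath h)
count-T k h = cong (bit (h 0) +_) (sumBelow-blocks 3 k (bit ∘ h ∘ suc))

chosenAt : (ℕ → Bool) → Role × ℕ → Bool
chosenAt β (head   , i) = false
chosenAt β (middle , i) = β i
chosenAt β (leaf   , i) = not (β i)

chosen : (ℕ → Bool) → ℕ → Bool
chosen β zero    = true
chosen β (suc j) = chosenAt β (locate (suc j))

chosen-vtx : ∀ β r i → chosen β (vtx r i) ≡ chosenAt β (r , i)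
chosen-vtx β r i = cong (chosenAt β) (locate-vtx r i)

one-per-path : ∀ β i → onPath (chosen β) i ≡ 1
one-per-path β i rewrite chosen-vtx β head i | chosen-vtx β middle i | chosen-vtx β leaf i with β i
... | true  = refl
... | false = refl

bit-true : ∀ {x} → x ≡ true → 1 ≤ bit x
bit-true refl = ≤-refl

module _ {k : ℕ} where

  private
    V = Fin (suc (3 * k))

  at-vertex : ∀ {w : V} r {i} (i<k : i < k) → toℕ w ≡ vtx r i → w ≡ vertex r i<k
  at-vertex r i<k w≡ = toℕ-injective (trans w≡ (sym (toℕ-vertex r i<k)))

  at-root : ∀ {w : V} → toℕ w ≡ 0 → w ≡ zero
  at-root = toℕ-injective

  Sβ : (ℕ → Bool) → Subset (suc (3 * k))
  Sβ β = tabulate (chosen β ∘ toℕ)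

  ∈Sβ⇔ : ∀ β {v} → v ∈ Sβ β ⇔ chosen β (toℕ v) ≡ true
  ∈Sβ⇔ β = ∈-tabulate (chosen β ∘ toℕ)

  vertex∈Sβ : ∀ β r {i} (i<k : i < k) → chosenAt β (r , i) ≡ true → vertex r i<k ∈ Sβ β
  vertex∈Sβ β r {i} i<k c = Equivalence.from (∈Sβ⇔ β)
    (trans (cong (chosen β) (toℕ-vertex r i<k)) (trans (chosen-vtx β r i) c))

  ∉Sβ : ∀ β {v} r {i} → toℕ v ≡ vtx r i → v ∉ Sβ β → chosenAt β (r , i) ≡ false
  ∉Sβ β {v} r {i} v≡ v∉ with chosenAt β (r , i) in c
  ... | false = refl
  ... | true  = contradiction
    (Equivalence.from (∈Sβ⇔ β) (trans (cong (chosen β) v≡) (trans (chosen-vtx β r i) c))) v∉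

  card-Sβ : ∀ β → ∣ Sβ β ∣ ≡ k + 1
  card-Sβ β = begin
    ∣ Sβ β ∣                                ≡⟨ card-tabulate (suc (3 * k)) (chosen β) ⟩
    sumBelow (suc (3 * k)) (bit ∘ chosen β) ≡⟨ count-T k (chosen β) ⟩
    1 + sumBelow k (onPath (chosen β))      ≡⟨ cong suc (sumBelow-ones k _ (λ {i} _ → one-per-path β i)) ⟩
    1 + k                                   ≡⟨ +-comm 1 k ⟩
    k + 1                                   ∎
    where open ≡-Reasoning

  adj-at : ∀ {v w : V} {x} → toℕ v ≡ x → adj (T k) v w ≡ true → Adjacent k x (toℕ w)
  adj-at {v} {w} refl vw = adj⇒adjacent k {v} {w} vw

  -- S_β is a [1,2]-set: heads see the root (and possibly m_i), a middle vertex
  -- outside S_β sees ℓ_i ∈ S_β (and u_i), a leaf outside S_β sees only m_i ∈ S_β.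
  Sβ-is12 : ∀ β → Is12Set (T k) (Sβ β)
  Sβ-is12 β v v∉ with position v
  ... | inj₁ v≡0 = contradiction (Equivalence.from (∈Sβ⇔ β) (cong (chosen β) v≡0)) v∉
  ... | inj₂ (head , i , i<k , v≡) =
      neighbour⇒card≥1 (T k) {v} {zero} (Sβ β) (proj₂ (edge⇒adj {v = zero} {w = v} (root-head i i<k refl v≡)))
        (Equivalence.from (∈Sβ⇔ β) refl)
    , neighbours⇒card≤2 (T k) {v} (Sβ β) zero (vertex middle i<k) λ {w} vw →
        Sum.map at-root (at-vertex middle i<k) (head-neighbours {i = i} (adj-at {v} {w} v≡ vw))
  ... | inj₂ (middle , i , i<k , v≡) =
      neighbour⇒card≥1 (T k) {v} (Sβ β)
        (proj₁ (edge⇒adj {v = v} {w = vertex leaf i<k} (middle-leaf i i<k v≡ (toℕ-vertex leaf i<k))))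
        (vertex∈Sβ β leaf i<k (cong not (∉Sβ β middle v≡ v∉)))
    , neighbours⇒card≤2 (T k) {v} (Sβ β) (vertex head i<k) (vertex leaf i<k) λ {w} vw →
        Sum.map (at-vertex head i<k) (at-vertex leaf i<k) (middle-neighbours {i = i} (adj-at {v} {w} v≡ vw))
  ... | inj₂ (leaf , i , i<k , v≡) =
      neighbour⇒card≥1 (T k) {v} (Sβ β)
        (proj₂ (edge⇒adj {v = vertex middle i<k} {w = v} (middle-leaf i i<k (toℕ-vertex middle i<k) v≡)))
        (vertex∈Sβ β middle i<k (not-injective (∉Sβ β leaf v≡ v∉)))
    , neighbours⇒card≤2 (T k) {v} (Sβ β) (vertex middle i<k) (vertex middle i<k) λ {w} vw →
        inj₁ (at-vertex middle i<k (leaf-neighbour {i = i} (adj-at {v} {w} v≡ vw)))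

  leaf-dominated : ∀ {S} → Is12Set (T k) S → ∀ {i} (i<k : i < k) →
                   vertex leaf i<k ∉ S → member S (m i) ≡ true
  leaf-dominated {S} is12 {i} i<k ℓ∉S =
    let w , ℓw , w∈S = dominated (T k) {v = vertex leaf i<k} is12 ℓ∉S
    in subst (λ j → member S j ≡ true)
             (leaf-neighbour {i = i} (adj-at {vertex leaf i<k} {w} (toℕ-vertex leaf i<k) ℓw)) (∈⇒member w∈S)

  root-dominated : ∀ {S} → Is12Set (T k) S → zero ∉ S → ∃[ i ] (i < k × member S (u i) ≡ true)
  root-dominated {S} is12 0∉S =
    let w , 0w , w∈S = dominated (T k) {v = zero} is12 0∉S
        i , i<k , w≡ = root-neighbours (adj-at {zero} {w} refl 0w)
    in i , i<k , subst (λ j → member S j ≡ true) w≡ (∈⇒member w∈S)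

  -- Every [1,2]-set has at least k + 1 vertices: each path meets S in m_i or ℓ_i,
  -- and either the root is in S or some u_i is an additional vertex of S.
  lower-bound : ∀ S → Is12Set (T k) S → k + 1 ≤ ∣ S ∣
  lower-bound S is12 = begin
    k + 1                                             ≡⟨ +-comm k 1 ⟩
    1 + k                                             ≤⟨ root-or-extra ⟩
    bit (member S 0) + sumBelow k (onPath (member S)) ≡⟨ sym (trans (card-member S) (count-T k (member S))) ⟩
    ∣ S ∣                                             ∎
    where
    open ≤-Reasoning

    not-in : ∀ {v} → member S (toℕ v) ≡ false → v ∉ S
    not-in out v∈S = contradiction (trans (sym out) (∈⇒member v∈S)) λ ()

    lower-met : ∀ {i} → i < k → 1 ≤ bit (member S (m i)) + (bit (member S (ℓ i)) + 0)
    lower-met {i} i<k with member S (ℓ i) in inℓ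
    ... | true  = m≤n+m 1 (bit (member S (m i)))
    ... | false = ≤-trans (bit-true (leaf-dominated {S} is12 i<k (not-in ℓ-out))) (m≤m+n _ _)
      where ℓ-out = trans (cong (member S) (toℕ-vertex leaf i<k)) inℓ

    path-met : ∀ {i} → i < k → 1 ≤ onPath (member S) i
    path-met {i} i<k = ≤-trans (lower-met i<k) (m≤n+m _ (bit (member S (u i))))

    root-or-extra : 1 + k ≤ bit (member S 0) + sumBelow k (onPath (member S))
    root-or-extra with member S 0 in in0
    ... | true  = s≤s (sumBelow-lower k _ path-met)
    ... | false = let i , i<k , head∈S = root-dominated {S} is12 (not-in {zero} in0)
                  in sumBelow-lower-strict k _ path-met i<k (+-mono-≤ (bit-true head∈S) (lower-met i<k))

  Sβ-minimum : ∀ β → IsGamma12Set (T k) (Sβ β)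
  Sβ-minimum β = Sβ-is12 β , λ S′ is12 → subst (_≤ ∣ S′ ∣) (sym (card-Sβ β)) (lower-bound S′ is12)

  γ-T : IsGamma12 (T k) (k + 1)
  γ-T = (Sβ (λ _ → true) , Sβ-is12 (λ _ → true) , card-Sβ (λ _ → true)) , lower-bound

  -- S_β records β i at m_i, so β ↦ S_β is injective on Boolean vectors.
  lookup-Sβ-middle : ∀ β {i} (i<k : i < k) → lookup (Sβ β) (vertex middle i<k) ≡ β i
  lookup-Sβ-middle β {i} i<k =
    trans (lookup∘tabulate (chosen β ∘ toℕ) (vertex middle i<k))
          (trans (cong (chosen β) (toℕ-vertex middle i<k)) (chosen-vtx β middle i))

  Sβ-injective : ∀ {b b′ : Vec Bool k} → Sβ (member b) ≡ Sβ (member b′) → b ≡ b′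
  Sβ-injective {b} {b′} eq = member-injective b b′ λ i<k →
    trans (sym (lookup-Sβ-middle (member b) i<k))
          (trans (cong (λ S → lookup S (vertex middle i<k)) eq) (lookup-Sβ-middle (member b′) i<k))

  many-γ-sets : ∃[ L ] (2 ^ k ≤ length L × Unique L × All (IsGamma12Set (T k)) L)
  many-γ-sets =
      map (Sβ ∘ member) (allVecs k)
    , ≤-reflexive (sym (trans (length-map (Sβ ∘ member) (allVecs k)) (length-allVecs k)))
    , Unique.map⁺ Sβ-injective (unique-allVecs k)
    , all-map⁺ (All.universal (Sβ-minimum ∘ member) (allVecs k))

n<2^n : ∀ n → n < 2 ^ n
n<2^n zero    = z<s
n<2^n (suc n) = begin-strict
  suc n           ≤⟨ n<2^n n ⟩
  2 ^ n           <⟨ m<m+n (2 ^ n) (m^n>0 2 n) ⟩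
  2 ^ n + 2 ^ n   ≡⟨ cong (2 ^ n +_) (sym (+-identityʳ (2 ^ n))) ⟩
  2 ^ suc n       ∎
  where open ≤-Reasoning

-- With s = 1 + a + 2b and t = 2s:  a + b·t < s·s ≤ 2^s · 2^s = 2^t.
linear-below-exp : ∀ a b → ∃[ t ] a + b * t < 2 ^ t
linear-below-exp a b = s + s , (begin-strict
  a + b * (s + s)             <⟨ +-mono-<-≤ (s≤s (m≤m+n a (2 * b))) (m≤n+m (b * (s + s)) (a * s)) ⟩
  s + (a * s + b * (s + s))   ≡⟨ sym (square a b) ⟩
  s * s                       ≤⟨ *-mono-≤ (<⇒≤ (n<2^n s)) (<⇒≤ (n<2^n s)) ⟩
  2 ^ s * 2 ^ s               ≡⟨ sym (^-distribˡ-+-* 2 s s) ⟩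
  2 ^ (s + s)                 ∎)
  where
  open ≤-Reasoning
  s = suc (a + 2 * b)
  square : ∀ x y → suc (x + 2 * y) * suc (x + 2 * y)
                 ≡ suc (x + 2 * y) + (x * suc (x + 2 * y) + y * (suc (x + 2 * y) + suc (x + 2 * y)))
  square = solve-∀

-- With k = 2^t: c(3k+1)^d + c ≤ 2^(1 + c + (2 + t)d) and 1 + c + (2 + t)d < 2^t = k.
poly-below-exp : ∀ c d → ∃[ k ] c * suc (3 * k) ^ d + c < 2 ^ k
poly-below-exp c d with linear-below-exp (suc (c + 2 * d)) d
... | t , linear = k , (begin-strict
  c * suc (3 * k) ^ d + c         ≤⟨ +-mono-≤ (*-mono-≤ c≤2^c base^d≤) c≤2^c*X ⟩
  2 ^ c * X + 2 ^ c * X           ≡⟨ doubling ⟩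
  2 ^ suc (c + (2 + t) * d)       <⟨ ^-monoʳ-< 2 (s≤s (s≤s z≤n)) (subst (_< k) (sym (exponent c d t)) linear) ⟩
  2 ^ k                           ∎)
  where
  open ≤-Reasoning
  k = 2 ^ t
  X = 2 ^ ((2 + t) * d)

  c≤2^c : c ≤ 2 ^ c
  c≤2^c = <⇒≤ (n<2^n c)

  c≤2^c*X : c ≤ 2 ^ c * X
  c≤2^c*X = ≤-trans c≤2^c (m≤m*n (2 ^ c) X {{>-nonZero (m^n>0 2 ((2 + t) * d))}})

  base≤ : suc (3 * k) ≤ 2 ^ (2 + t)
  base≤ = begin
    suc (3 * k)   ≤⟨ +-monoˡ-≤ (3 * k) (m^n>0 2 t) ⟩
    k + 3 * k     ≡⟨ four k ⟩
    2 * (2 * k)   ∎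
    where
    four : ∀ k → k + 3 * k ≡ 2 * (2 * k)
    four = solve-∀

  base^d≤ : suc (3 * k) ^ d ≤ X
  base^d≤ = ≤-trans (^-monoˡ-≤ d base≤) (≤-reflexive (^-*-assoc 2 (2 + t) d))

  doubling : 2 ^ c * X + 2 ^ c * X ≡ 2 ^ suc (c + (2 + t) * d)
  doubling = trans (cong (λ y → y + y) (sym (^-distribˡ-+-* 2 c ((2 + t) * d))))
                   (cong (2 ^ (c + (2 + t) * d) +_) (sym (+-identityʳ _)))

  exponent : ∀ c d t → suc (c + (2 + t) * d) ≡ suc (c + 2 * d) + d * t
  exponent = solve-∀

no-polynomial-bound :
  ¬ (∃[ c ] ∃[ d ] ∀ (n : ℕ) (G : Graph n) → IsTree G →
       ∀ (L : List (Subset n)) → Unique L → All (IsGamma12Set G) L → length L ≤ c * n ^ d + c)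
no-polynomial-bound (c , d , bound) with poly-below-exp c d
... | k , small with many-γ-sets {k}
...   | L , many , unique , minimum =
  <-irrefl refl (≤-<-trans (≤-trans many (bound (suc (3 * k)) (T k) (T-tree {k}) L unique minimum)) small)

mainTheorem4 : ((k : ℕ) → 1 ≤ k →
    IsTree (T k)
    × IsGamma12 (T k) (k + 1)
    × ∃[ L ] (2 ^ k ≤ length L × Unique L × All (IsGamma12Set (T k)) L))
    × ¬ (∃[ c ] ∃[ d ] ∀ (n : ℕ) (G : Graph n) → IsTree G →
    ∀ (L : List (Subset n)) → Unique L → All (IsGamma12Set G) L →
    length L ≤ c * n ^ d + c)
mainTheorem4 = (λ k _ → T-tree {k} , γ-T {k} , many-γ-sets {k}) , no-polynomial-bound
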